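{- Let $V$ be a finite set and $\mathcal{R}$ a dense set of betweenness triplets on $V$. Then $\mathcal{R}$ is consistent if and only if there is no set $C\subseteq V$ with $|C|=4$ such that $\mathcal{R}[C]$ is inconsistent.
   Context: A betweenness triplet on $\{a,b,c\}$ chooses one of its three elements; $abc$ denotes the triplet on $\{a,b,c\}$ choosing $b$. $\mathcal{R}$ is dense if it contains exactly one triplet on each 3-subset of $V$. A triplet $abc$ is consistent with a linear ordering $\sigma$ of $V$ if $b$ lies between $a$ and $c$ in $\sigma$. A set of triplets on a set $S$ is consistent if some linear ordering of $S$ is consistent with all of them, and inconsistent otherwise. $\mathcal{R}[C]=\{t\in\mathcal{R}:V(t)\subseteq C\}$. -}

module Defs where

open import Data.Nat using (ℕ; _<_)
open import Data.Fin using (Fin)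
open import Data.Fin.Subset using (Subset; _∈_)
open import Data.Product using (Σ; ∃; _×_; _,_)
open import Data.Sum using (_⊎_)
open import Relation.Nullary using (¬_)
open import Relation.Binary.PropositionalEquality using (_≡_; _≢_)
open import Function.Bundles using (_⇔_)

-- The ground set V is Fin n.
-- A betweenness triplet on the 3-set {a,b,c} choosing b, written abc.
record Triplet (n : ℕ) : Set where
  constructor triplet
  field
    a b c : Fin n
    a≢b : a ≢ b
    b≢c : b ≢ c
    a≢c : a ≢ c
open Triplet public

_∈V_ : ∀ {n} → Fin n → Triplet n → Set
v ∈V t = v ≡ a t ⊎ v ≡ b t ⊎ v ≡ c t

-- abc and cba denote the same triplet: same 3-set, same chosen element
SameTriplet : ∀ {n} → Triplet n → Triplet n → Set
SameTriplet t u = b t ≡ b u × ((a t ≡ a u × c t ≡ c u) ⊎ (a t ≡ c u × c t ≡ a u))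

-- a set of triplets: a predicate on triplets respecting triplet identity
TripletPred : ℕ → Set₁
TripletPred n = Triplet n → Set

RespectsSame : ∀ {n} → TripletPred n → Set
RespectsSame {n} R = ∀ (t u : Triplet n) → SameTriplet t u → R t → R u

-- dense: exactly one triplet on each 3-subset {x,y,z} of V
Dense : ∀ {n} → TripletPred n → Set
Dense {n} R =
  ∀ (x y z : Fin n) → x ≢ y → y ≢ z → x ≢ z →
    Σ (Triplet n) (λ t → R t × (∀ v → (v ∈V t) ⇔ (v ≡ x ⊎ v ≡ y ⊎ v ≡ z)))
    × (∀ (t u : Triplet n) → R t → R u →
         (∀ v → (v ∈V t) ⇔ (v ≡ x ⊎ v ≡ y ⊎ v ≡ z)) →
         (∀ v → (v ∈V u) ⇔ (v ≡ x ⊎ v ≡ y ⊎ v ≡ z)) →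
         SameTriplet t u)

ConsistentWith : ∀ {n} → (Fin n → ℕ) → Triplet n → Set
ConsistentWith σ t =
  (σ (a t) < σ (b t) × σ (b t) < σ (c t)) ⊎ (σ (c t) < σ (b t) × σ (b t) < σ (a t))

-- a linear ordering of S ⊆ V: positions σ that are injective on S
LinearOrderingOn : ∀ {n} → Subset n → (Fin n → ℕ) → Set
LinearOrderingOn {n} S σ = ∀ (x y : Fin n) → x ∈ S → y ∈ S → σ x ≡ σ y → x ≡ y

Consistent : ∀ {n} → Subset n → TripletPred n → Set
Consistent {n} S T =
  Σ (Fin n → ℕ) (λ σ → LinearOrderingOn S σ × (∀ t → T t → ConsistentWith σ t))

Restrict : ∀ {n} → TripletPred n → Subset n → TripletPred n
Restrict R C t = R t × (∀ v → v ∈V t → v ∈ C)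

-- Forward, consistency is inherited by restrictions.  Backward, fix distinct points p and q.
-- Every other point x lies either "left" of p (p between x and q) or "right" of it.  Order
-- the left points towards p, then p, then the right points away from p.  Each fact needed
-- to see that this is a strict total order making every triplet of R consistent involves
-- only four points, so it follows from the consistency of R on four-point sets; these
-- four-point facts are checked once and for all by enumerating the linear orders of four
-- points.  Counting predecessors finally turns the strict total order into positions in ℕ.
module Submission where

open import Defs
open import Data.Bool using (Bool; true; false; not; _∧_; _∨_; T)
open import Data.Bool.ListAction using (all)
open import Data.Bool.Properties using (T-∧; T-∨; T-≡)
open import Data.Empty using (⊥; ⊥-elim)
open import Data.Fin using (Fin; zero; suc; toℕ)
open import Data.Fin.Patterns using (0F; 1F; 2F; 3F)
open import Data.Fin.Properties using (_≟_; toℕ-injective)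
open import Data.Fin.Subset using (Subset; ⊤; ∣_∣; ⁅_⁆; _∪_; _∈_; _∉_; _⊆_; inside; outside)
open import Data.Fin.Subset.Properties
  using (∪-identityˡ; p⊂q⇒∣p∣<∣q∣; x∈⁅x⁆; x∈⁅y⁆⇒x≡y; x∈p∪q⁻; x∈p∪q⁺; ∣⁅x⁆∣≡1; ⊆⊤)
open import Data.List using (List; []; _∷_; allFin)
open import Data.List.Relation.Unary.All as All using (All; []; _∷_; universal)
open import Data.List.Relation.Unary.All.Properties using (all⁻)
open import Data.Nat using (ℕ; zero; suc; _<_; _<ᵇ_)
import Data.Nat.Properties as ℕ
open import Data.Product as × using (Σ; _×_; _,_; proj₁; proj₂)
open import Data.Product.Function.NonDependent.Propositional using (_×-⇔_)
open import Data.Sum as ⊎ using (_⊎_; inj₁; inj₂; [_,_]; map₂; swap)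
open import Data.Sum.Function.Propositional using (_⊎-⇔_)
open import Data.Unit as Unit using (tt)
open import Data.Vec using (Vec; []; _∷_; lookup; tabulate; here; there)
open import Data.Vec.Properties using (lookup∘tabulate; []=⇒lookup; lookup⇒[]=)
open import Function using (_∘_)
open import Function.Bundles using (_⇔_; mk⇔; Equivalence)
open import Function.Construct.Composition using (_⇔-∘_)
open import Function.Construct.Identity using (⇔-id)
open import Level using (0ℓ)
open import Relation.Binary using (Rel; IsStrictTotalOrder; Tri; tri<; tri≈; tri>)
open import Relation.Binary.PropositionalEquality
  using (_≡_; _≢_; refl; sym; trans; cong; isEquivalence; resp₂)
open import Relation.Nullary using (¬_; Dec; yes; no; ¬?; isYes)
open import Relation.Nullary.Decidable using (toWitness; fromWitness; decidable-stable)

module _ {n ℓ} {_≺_ : Rel (Fin n) ℓ} (≺-isStrictTotalOrder : IsStrictTotalOrder _≡_ _≺_) where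
  open IsStrictTotalOrder ≺-isStrictTotalOrder using (compare; _<?_; irrefl) renaming (trans to ≺-trans)

  predecessors : Fin n → Subset n
  predecessors y = tabulate (λ x → isYes (x <? y))

  ∈-predecessors : ∀ {x y} → x ∈ predecessors y ⇔ x ≺ y
  ∈-predecessors {x} {y} = mk⇔
    (λ x∈ → toWitness (Equivalence.from T-≡ (trans (sym (lookup∘tabulate _ x)) ([]=⇒lookup x∈))))
    (λ x≺y → lookup⇒[]= x _ (trans (lookup∘tabulate _ x) (Equivalence.to T-≡ (fromWitness x≺y))))

  rank : Fin n → ℕ
  rank y = ∣ predecessors y ∣

  rank-monotone : ∀ {x y} → x ≺ y → rank x < rank y
  rank-monotone {x} {y} x≺y =
    p⊂q⇒∣p∣<∣q∣ (predecessors-⊆ , x , from ∈-predecessors x≺y , λ x∈ → irrefl refl (to ∈-predecessors x∈))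
    where
    open Equivalence using (to; from)
    predecessors-⊆ : predecessors x ⊆ predecessors y
    predecessors-⊆ z∈ = from ∈-predecessors (≺-trans (to ∈-predecessors z∈) x≺y)

  rank-injective : ∀ {x y} → rank x ≡ rank y → x ≡ y
  rank-injective {x} {y} eq with compare x y
  ... | tri< x≺y _ _ = ⊥-elim (ℕ.<-irrefl eq (rank-monotone x≺y))
  ... | tri≈ _ x≡y _ = x≡y
  ... | tri> _ _ y≺x = ⊥-elim (ℕ.<-irrefl (sym eq) (rank-monotone y≺x))

∣⁅x⁆∪p∣≡1+∣p∣ : ∀ {m} (x : Fin m) (p : Subset m) → x ∉ p → ∣ ⁅ x ⁆ ∪ p ∣ ≡ suc ∣ p ∣
∣⁅x⁆∪p∣≡1+∣p∣ zero    (outside ∷ p) x∉p = cong suc (cong ∣_∣ (∪-identityˡ p))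
∣⁅x⁆∪p∣≡1+∣p∣ zero    (inside ∷ p)  x∉p = ⊥-elim (x∉p here)
∣⁅x⁆∪p∣≡1+∣p∣ (suc x) (outside ∷ p) x∉p = ∣⁅x⁆∪p∣≡1+∣p∣ x p (x∉p ∘ there)
∣⁅x⁆∪p∣≡1+∣p∣ (suc x) (inside ∷ p)  x∉p = cong suc (∣⁅x⁆∪p∣≡1+∣p∣ x p (x∉p ∘ there))

_⇒ᵇ_ : Bool → Bool → Bool
x ⇒ᵇ y = not x ∨ y

T-⇒ᵇ : ∀ {x y} → T (x ⇒ᵇ y) ⇔ (T x → T y)
T-⇒ᵇ {true}  = mk⇔ (λ h _ → h) (λ f → f _)
T-⇒ᵇ {false} = mk⇔ (λ _ ()) (λ _ → _)

T-not : ∀ {x} → T (not x) ⇔ (¬ T x)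
T-not {true}  = mk⇔ (λ ()) (λ ¬t → ¬t _)
T-not {false} = mk⇔ (λ _ ()) (λ _ → _)

T-<ᵇ : ∀ m n → T (m <ᵇ n) ⇔ m < n
T-<ᵇ m n = mk⇔ (ℕ.<ᵇ⇒< m n) ℕ.<⇒<ᵇ

T-not->ᵇ : ∀ {m n} → m ≢ n → T (not (n <ᵇ m)) ⇔ m < n
T-not->ᵇ {m} {n} m≢n = mk⇔
  (λ h → ℕ.≤∧≢⇒< (ℕ.≮⇒≥ (Equivalence.to T-not h ∘ ℕ.<⇒<ᵇ)) m≢n)
  (λ m<n → Equivalence.from T-not (ℕ.<-asym m<n ∘ ℕ.<ᵇ⇒< n m))

Btwℕ : ℕ → ℕ → ℕ → Set
Btwℕ i j k = (i < j × j < k) ⊎ (k < j × j < i)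

Btwℕ⇒≢₁₂ : ∀ {i j k} → Btwℕ i j k → i ≢ j
Btwℕ⇒≢₁₂ (inj₁ (i<j , _)) = ℕ.<⇒≢ i<j
Btwℕ⇒≢₁₂ (inj₂ (_ , j<i)) = ℕ.>⇒≢ j<i

Btwℕ⇒≢₂₃ : ∀ {i j k} → Btwℕ i j k → j ≢ k
Btwℕ⇒≢₂₃ (inj₁ (_ , j<k)) = ℕ.<⇒≢ j<k
Btwℕ⇒≢₂₃ (inj₂ (k<j , _)) = ℕ.>⇒≢ k<j

Btwℕ⇒≢₁₃ : ∀ {i j k} → Btwℕ i j k → i ≢ k
Btwℕ⇒≢₁₃ (inj₁ (i<j , j<k)) = ℕ.<⇒≢ (ℕ.<-trans i<j j<k)
Btwℕ⇒≢₁₃ (inj₂ (k<j , j<i)) = ℕ.>⇒≢ (ℕ.<-trans k<j j<i)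

Btwℕ-unique₁₂ : ∀ {i j k} → Btwℕ i j k → ¬ Btwℕ j i k
Btwℕ-unique₁₂ (inj₁ (i<j , _))   (inj₁ (j<i , _)) = ℕ.<-asym i<j j<i
Btwℕ-unique₁₂ (inj₁ (i<j , j<k)) (inj₂ (k<i , _)) = ℕ.<-asym (ℕ.<-trans i<j j<k) k<i
Btwℕ-unique₁₂ (inj₂ (k<j , j<i)) (inj₁ (_ , i<k)) = ℕ.<-asym (ℕ.<-trans k<j j<i) i<k
Btwℕ-unique₁₂ (inj₂ (_ , j<i))   (inj₂ (_ , i<j)) = ℕ.<-asym j<i i<j

Btwℕ-unique₂₃ : ∀ {i j k} → Btwℕ i j k → ¬ Btwℕ i k j
Btwℕ-unique₂₃ (inj₁ (_ , j<k))   (inj₁ (_ , k<j)) = ℕ.<-asym j<k k<j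
Btwℕ-unique₂₃ (inj₁ (i<j , j<k)) (inj₂ (_ , k<i)) = ℕ.<-asym (ℕ.<-trans i<j j<k) k<i
Btwℕ-unique₂₃ (inj₂ (k<j , j<i)) (inj₁ (i<k , _)) = ℕ.<-asym (ℕ.<-trans k<j j<i) i<k
Btwℕ-unique₂₃ (inj₂ (k<j , _))   (inj₂ (j<k , _)) = ℕ.<-asym k<j j<k

-- A relation on four points given by its six comparisons i before j, for ij = 01, 02, 03, 12,
-- 13, 23; those passing isTransitive are exactly the linear orders of the four points.
Order4 : Set
Order4 = Vec Bool 6

precedes : Order4 → Fin 4 → Fin 4 → Bool
precedes (b₀₁ ∷ b₀₂ ∷ b₀₃ ∷ b₁₂ ∷ b₁₃ ∷ b₂₃ ∷ []) = table
  where
  table : Fin 4 → Fin 4 → Bool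
  table 0F 1F = b₀₁
  table 0F 2F = b₀₂
  table 0F 3F = b₀₃
  table 1F 2F = b₁₂
  table 1F 3F = b₁₃
  table 2F 3F = b₂₃
  table 1F 0F = not b₀₁
  table 2F 0F = not b₀₂
  table 3F 0F = not b₀₃
  table 2F 1F = not b₁₂
  table 3F 1F = not b₁₃
  table 3F 2F = not b₂₃
  table _  _  = false

∀-Fin4 : (Fin 4 → Bool) → Bool
∀-Fin4 f = all f (allFin 4)

∀-Fin4-complete : ∀ f → (∀ i → T (f i)) → T (∀-Fin4 f)
∀-Fin4-complete f f-holds = all⁻ f (universal f-holds (allFin 4))

transitiveAt : Order4 → Fin 4 → Fin 4 → Fin 4 → Bool
transitiveAt o i j k = (precedes o i j ∧ precedes o j k) ⇒ᵇ precedes o i k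

isTransitive : Order4 → Bool
isTransitive o = ∀-Fin4 λ i → ∀-Fin4 λ j → ∀-Fin4 λ k → transitiveAt o i j k

isTransitive-complete : ∀ o → (∀ i j k → T (precedes o i j) → T (precedes o j k) → T (precedes o i k)) →
                        T (isTransitive o)
isTransitive-complete o o-trans =
  ∀-Fin4-complete (λ i → ∀-Fin4 λ j → ∀-Fin4 (transitiveAt o i j)) λ i →
  ∀-Fin4-complete (λ j → ∀-Fin4 (transitiveAt o i j)) λ j →
  ∀-Fin4-complete (transitiveAt o i j) λ k →
  Equivalence.from T-⇒ᵇ λ ij∧jk →
    let ij , jk = Equivalence.to (T-∧ {precedes o i j}) ij∧jk in o-trans i j k ij jk

between : Order4 → Fin 4 → Fin 4 → Fin 4 → Bool
between o i j k = (precedes o i j ∧ precedes o j k) ∨ (precedes o k j ∧ precedes o j i)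

data Literal : Set where
  btw ¬btw : Fin 4 → Fin 4 → Fin 4 → Literal

holds : Order4 → Literal → Bool
holds o (btw i j k)  = between o i j k
holds o (¬btw i j k) = not (between o i j k)

∀-Vec : ∀ k → (Vec Bool k → Bool) → Bool
∀-Vec zero    f = f []
∀-Vec (suc k) f = ∀-Vec k (f ∘ (true ∷_)) ∧ ∀-Vec k (f ∘ (false ∷_))

∀-Vec-sound : ∀ k (f : Vec Bool k → Bool) → T (∀-Vec k f) → ∀ v → T (f v)
∀-Vec-sound zero    f h []          = h
∀-Vec-sound (suc k) f h (true ∷ v)  = ∀-Vec-sound k _ (proj₁ (Equivalence.to T-∧ h)) v
∀-Vec-sound (suc k) f h (false ∷ v) =
  ∀-Vec-sound k _ (proj₂ (Equivalence.to (T-∧ {∀-Vec k (f ∘ (true ∷_))}) h)) v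

_⊨_⇒_ : Order4 → List Literal → Literal → Bool
o ⊨ hs ⇒ l = (isTransitive o ∧ all (holds o) hs) ⇒ᵇ holds o l

_⊢_ : List Literal → Literal → Bool
hs ⊢ l = ∀-Vec 6 λ o → o ⊨ hs ⇒ l

⊢-sound : ∀ hs l → T (hs ⊢ l) → ∀ o → T (isTransitive o) → All (T ∘ holds o) hs → T (holds o l)
⊢-sound hs l valid o o-transitive hs-hold =
  Equivalence.to (T-⇒ᵇ {isTransitive o ∧ all (holds o) hs}) (∀-Vec-sound 6 (_⊨ hs ⇒ l) valid o)
    (Equivalence.from T-∧ (o-transitive , all⁻ (holds o) hs-hold))

OneOf : ∀ {A : Set} → A → A → A → A → Set
OneOf x y z v = v ≡ x ⊎ v ≡ y ⊎ v ≡ z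

OneOf-swap₁₂ : ∀ {A : Set} {x y z : A} v → OneOf y x z v ⇔ OneOf x y z v
OneOf-swap₁₂ v = mk⇔ swap₁₂ swap₁₂
  where
  swap₁₂ : ∀ {A B C : Set} → A ⊎ B ⊎ C → B ⊎ A ⊎ C
  swap₁₂ = [ inj₂ ∘ inj₁ , map₂ inj₂ ]

OneOf-swap₂₃ : ∀ {A : Set} {x y z : A} v → OneOf x z y v ⇔ OneOf x y z v
OneOf-swap₂₃ v = mk⇔ (map₂ swap) (map₂ swap)

module Betweenness {n : ℕ} (R : TripletPred n) (R-resp : RespectsSame R) (R-dense : Dense R) where

  data Btw (x y z : Fin n) : Set where
    via : (t : Triplet n) → R t → a t ≡ x → b t ≡ y → c t ≡ z → Btw x y z

  Btw-sym : ∀ {x y z} → Btw x y z → Btw z y x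
  Btw-sym (via t@(triplet _ _ _ a≢b b≢c a≢c) r refl refl refl) =
    via (triplet _ _ _ (b≢c ∘ sym) (a≢b ∘ sym) (a≢c ∘ sym)) (R-resp t _ (refl , inj₂ (refl , refl)) r)
        refl refl refl

  Btw⇒≢₁₂ : ∀ {x y z} → Btw x y z → x ≢ y
  Btw⇒≢₁₂ (via t _ refl refl refl) = a≢b t

  Btw⇒≢₂₃ : ∀ {x y z} → Btw x y z → y ≢ z
  Btw⇒≢₂₃ (via t _ refl refl refl) = b≢c t

  Btw⇒≢₁₃ : ∀ {x y z} → Btw x y z → x ≢ z
  Btw⇒≢₁₃ (via t _ refl refl refl) = a≢c t

  Btw-middle-unique : ∀ {x y z x′ y′ z′} → Btw x y z → Btw x′ y′ z′ →
                      (∀ v → OneOf x′ y′ z′ v ⇔ OneOf x y z v) → y ≡ y′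
  Btw-middle-unique {x} {y} {z} h@(via t r refl refl refl) (via u r′ refl refl refl) same =
    proj₁ (proj₂ (R-dense x y z (Btw⇒≢₁₂ h) (Btw⇒≢₂₃ h) (Btw⇒≢₁₃ h)) t u r r′ (λ _ → ⇔-id _) same)

  Btw-unique₁₂ : ∀ {x y z} → Btw x y z → ¬ Btw y x z
  Btw-unique₁₂ h h′ = Btw⇒≢₁₂ h (sym (Btw-middle-unique h h′ OneOf-swap₁₂))

  Btw-unique₂₃ : ∀ {x y z} → Btw x y z → ¬ Btw x z y
  Btw-unique₂₃ h h′ = Btw⇒≢₂₃ h (Btw-middle-unique h h′ OneOf-swap₂₃)

  private
    arrange : ∀ {x y z a b c} → Btw a b c → OneOf x y z a → OneOf x y z b → OneOf x y z c →
              Btw x y z ⊎ Btw y x z ⊎ Btw x z y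
    arrange h (inj₁ refl)        (inj₁ refl)        _                  = ⊥-elim (Btw⇒≢₁₂ h refl)
    arrange h (inj₁ refl)        (inj₂ (inj₁ refl)) (inj₁ refl)        = ⊥-elim (Btw⇒≢₁₃ h refl)
    arrange h (inj₁ refl)        (inj₂ (inj₁ refl)) (inj₂ (inj₁ refl)) = ⊥-elim (Btw⇒≢₂₃ h refl)
    arrange h (inj₁ refl)        (inj₂ (inj₁ refl)) (inj₂ (inj₂ refl)) = inj₁ h
    arrange h (inj₁ refl)        (inj₂ (inj₂ refl)) (inj₁ refl)        = ⊥-elim (Btw⇒≢₁₃ h refl)
    arrange h (inj₁ refl)        (inj₂ (inj₂ refl)) (inj₂ (inj₁ refl)) = inj₂ (inj₂ h)
    arrange h (inj₁ refl)        (inj₂ (inj₂ refl)) (inj₂ (inj₂ refl)) = ⊥-elim (Btw⇒≢₂₃ h refl)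
    arrange h (inj₂ (inj₁ refl)) (inj₁ refl)        (inj₁ refl)        = ⊥-elim (Btw⇒≢₂₃ h refl)
    arrange h (inj₂ (inj₁ refl)) (inj₁ refl)        (inj₂ (inj₁ refl)) = ⊥-elim (Btw⇒≢₁₃ h refl)
    arrange h (inj₂ (inj₁ refl)) (inj₁ refl)        (inj₂ (inj₂ refl)) = inj₂ (inj₁ h)
    arrange h (inj₂ (inj₁ refl)) (inj₂ (inj₁ refl)) _                  = ⊥-elim (Btw⇒≢₁₂ h refl)
    arrange h (inj₂ (inj₁ refl)) (inj₂ (inj₂ refl)) (inj₁ refl)        = inj₂ (inj₂ (Btw-sym h))
    arrange h (inj₂ (inj₁ refl)) (inj₂ (inj₂ refl)) (inj₂ (inj₁ refl)) = ⊥-elim (Btw⇒≢₁₃ h refl)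
    arrange h (inj₂ (inj₁ refl)) (inj₂ (inj₂ refl)) (inj₂ (inj₂ refl)) = ⊥-elim (Btw⇒≢₂₃ h refl)
    arrange h (inj₂ (inj₂ refl)) (inj₁ refl)        (inj₁ refl)        = ⊥-elim (Btw⇒≢₂₃ h refl)
    arrange h (inj₂ (inj₂ refl)) (inj₁ refl)        (inj₂ (inj₁ refl)) = inj₂ (inj₁ (Btw-sym h))
    arrange h (inj₂ (inj₂ refl)) (inj₁ refl)        (inj₂ (inj₂ refl)) = ⊥-elim (Btw⇒≢₁₃ h refl)
    arrange h (inj₂ (inj₂ refl)) (inj₂ (inj₁ refl)) (inj₁ refl)        = inj₁ (Btw-sym h)
    arrange h (inj₂ (inj₂ refl)) (inj₂ (inj₁ refl)) (inj₂ (inj₁ refl)) = ⊥-elim (Btw⇒≢₂₃ h refl)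
    arrange h (inj₂ (inj₂ refl)) (inj₂ (inj₁ refl)) (inj₂ (inj₂ refl)) = ⊥-elim (Btw⇒≢₁₃ h refl)
    arrange h (inj₂ (inj₂ refl)) (inj₂ (inj₂ refl)) _                  = ⊥-elim (Btw⇒≢₁₂ h refl)

  Btw-trichotomy : ∀ {x y z} → x ≢ y → y ≢ z → x ≢ z → Btw x y z ⊎ Btw y x z ⊎ Btw x z y
  Btw-trichotomy {x} {y} {z} x≢y y≢z x≢z with proj₁ (R-dense x y z x≢y y≢z x≢z)
  ... | t , r , vertices = arrange (via t r refl refl refl)
          (to (vertices (a t)) (inj₁ refl)) (to (vertices (b t)) (inj₂ (inj₁ refl)))
          (to (vertices (c t)) (inj₂ (inj₂ refl)))
    where open Equivalence

  Btw? : ∀ x y z → Dec (Btw x y z)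
  Btw? x y z with x ≟ y | y ≟ z | x ≟ z
  ... | yes x≡y | _       | _       = no λ h → Btw⇒≢₁₂ h x≡y
  ... | no _    | yes y≡z | _       = no λ h → Btw⇒≢₂₃ h y≡z
  ... | no _    | no _    | yes x≡z = no λ h → Btw⇒≢₁₃ h x≡z
  ... | no x≢y  | no y≢z  | no x≢z with Btw-trichotomy x≢y y≢z x≢z
  ... | inj₁ h        = yes h
  ... | inj₂ (inj₁ h) = no (Btw-unique₁₂ h)
  ... | inj₂ (inj₂ h) = no (Btw-unique₂₃ h)

FourPointConsistent : ∀ {n} → TripletPred n → Set
FourPointConsistent {n} R = ∀ (C : Subset n) → ∣ C ∣ ≡ 4 → ¬ ¬ Consistent C (Restrict R C)

module FromFourPoints {n : ℕ} (R : TripletPred n) (R-resp : RespectsSame R) (R-dense : Dense R)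
                      (R-4 : FourPointConsistent R) where
  open Betweenness R R-resp R-dense

  module _ {w₀ w₁ w₂ w₃ : Fin n} (w₀≢w₁ : w₀ ≢ w₁) (w₀≢w₂ : w₀ ≢ w₂) (w₀≢w₃ : w₀ ≢ w₃)
           (w₁≢w₂ : w₁ ≢ w₂) (w₁≢w₃ : w₁ ≢ w₃) (w₂≢w₃ : w₂ ≢ w₃) where

    private
      w : Fin 4 → Fin n
      w = lookup (w₀ ∷ w₁ ∷ w₂ ∷ w₃ ∷ [])

      C : Subset n
      C = ⁅ w₀ ⁆ ∪ ⁅ w₁ ⁆ ∪ ⁅ w₂ ⁆ ∪ ⁅ w₃ ⁆

      ∉⁅⁆ : ∀ {x y : Fin n} → x ≢ y → x ∉ ⁅ y ⁆
      ∉⁅⁆ {y = y} x≢y = x≢y ∘ x∈⁅y⁆⇒x≡y y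

      ∉∪ : ∀ {x : Fin n} p q → x ∉ p → x ∉ q → x ∉ p ∪ q
      ∉∪ p q x∉p x∉q = [ x∉p , x∉q ] ∘ x∈p∪q⁻ p q

      ∣C∣≡4 : ∣ C ∣ ≡ 4
      ∣C∣≡4 =
        trans (∣⁅x⁆∪p∣≡1+∣p∣ w₀ _ (∉∪ ⁅ w₁ ⁆ _ (∉⁅⁆ w₀≢w₁) (∉∪ ⁅ w₂ ⁆ _ (∉⁅⁆ w₀≢w₂) (∉⁅⁆ w₀≢w₃)))) (cong suc
        (trans (∣⁅x⁆∪p∣≡1+∣p∣ w₁ _ (∉∪ ⁅ w₂ ⁆ _ (∉⁅⁆ w₁≢w₂) (∉⁅⁆ w₁≢w₃))) (cong suc
        (trans (∣⁅x⁆∪p∣≡1+∣p∣ w₂ _ (∉⁅⁆ w₂≢w₃)) (cong suc (∣⁅x⁆∣≡1 w₃))))))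

      w∈C : ∀ i → w i ∈ C
      w∈C 0F = x∈p∪q⁺ (inj₁ (x∈⁅x⁆ w₀))
      w∈C 1F = x∈p∪q⁺ {p = ⁅ w₀ ⁆} (inj₂ (x∈p∪q⁺ (inj₁ (x∈⁅x⁆ w₁))))
      w∈C 2F = x∈p∪q⁺ {p = ⁅ w₀ ⁆} (inj₂ (x∈p∪q⁺ {p = ⁅ w₁ ⁆} (inj₂ (x∈p∪q⁺ (inj₁ (x∈⁅x⁆ w₂))))))
      w∈C 3F =
        x∈p∪q⁺ {p = ⁅ w₀ ⁆} (inj₂ (x∈p∪q⁺ {p = ⁅ w₁ ⁆} (inj₂ (x∈p∪q⁺ {p = ⁅ w₂ ⁆} (inj₂ (x∈⁅x⁆ w₃))))))

    Holds : Literal → Set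
    Holds (btw i j k)  = Btw (w i) (w j) (w k)
    Holds (¬btw i j k) = ¬ Btw (w i) (w j) (w k)

    private
      Holds? : ∀ l → Dec (Holds l)
      Holds? (btw i j k)  = Btw? (w i) (w j) (w k)
      Holds? (¬btw i j k) = ¬? (Btw? (w i) (w j) (w k))

      module Ordered (σ : Fin n → ℕ) (σ-injective : LinearOrderingOn C σ)
                     (σ-consistent : ∀ t → Restrict R C t → ConsistentWith σ t) where

        Btw⇒Btwℕ : ∀ {x y z} → x ∈ C → y ∈ C → z ∈ C → Btw x y z → Btwℕ (σ x) (σ y) (σ z)
        Btw⇒Btwℕ x∈C y∈C z∈C (via t r refl refl refl) = σ-consistent t (r , vertices∈C)
          where
          vertices∈C : ∀ v → v ∈V t → v ∈ C
          vertices∈C v (inj₁ refl)        = x∈C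
          vertices∈C v (inj₂ (inj₁ refl)) = y∈C
          vertices∈C v (inj₂ (inj₂ refl)) = z∈C

        Btwℕ⇒Btw : ∀ {x y z} → x ∈ C → y ∈ C → z ∈ C → Btwℕ (σ x) (σ y) (σ z) → Btw x y z
        Btwℕ⇒Btw x∈C y∈C z∈C h
          with Btw-trichotomy (Btwℕ⇒≢₁₂ h ∘ cong σ) (Btwℕ⇒≢₂₃ h ∘ cong σ) (Btwℕ⇒≢₁₃ h ∘ cong σ)
        ... | inj₁ h′        = h′
        ... | inj₂ (inj₁ h′) = ⊥-elim (Btwℕ-unique₁₂ h (Btw⇒Btwℕ y∈C x∈C z∈C h′))
        ... | inj₂ (inj₂ h′) = ⊥-elim (Btwℕ-unique₂₃ h (Btw⇒Btwℕ x∈C z∈C y∈C h′))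

        order : Order4
        order = (σ w₀ <ᵇ σ w₁) ∷ (σ w₀ <ᵇ σ w₂) ∷ (σ w₀ <ᵇ σ w₃)
              ∷ (σ w₁ <ᵇ σ w₂) ∷ (σ w₁ <ᵇ σ w₃) ∷ (σ w₂ <ᵇ σ w₃) ∷ []

        σ-≢ : ∀ i j → w j ≢ w i → σ (w i) ≢ σ (w j)
        σ-≢ i j wj≢wi = wj≢wi ∘ sym ∘ σ-injective _ _ (w∈C i) (w∈C j)

        T-precedes : ∀ i j → T (precedes order i j) ⇔ σ (w i) < σ (w j)
        T-precedes 0F 1F = T-<ᵇ _ _
        T-precedes 0F 2F = T-<ᵇ _ _
        T-precedes 0F 3F = T-<ᵇ _ _
        T-precedes 1F 2F = T-<ᵇ _ _
        T-precedes 1F 3F = T-<ᵇ _ _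
        T-precedes 2F 3F = T-<ᵇ _ _
        T-precedes 1F 0F = T-not->ᵇ (σ-≢ 1F 0F w₀≢w₁)
        T-precedes 2F 0F = T-not->ᵇ (σ-≢ 2F 0F w₀≢w₂)
        T-precedes 3F 0F = T-not->ᵇ (σ-≢ 3F 0F w₀≢w₃)
        T-precedes 2F 1F = T-not->ᵇ (σ-≢ 2F 1F w₁≢w₂)
        T-precedes 3F 1F = T-not->ᵇ (σ-≢ 3F 1F w₁≢w₃)
        T-precedes 3F 2F = T-not->ᵇ (σ-≢ 3F 2F w₂≢w₃)
        T-precedes 0F 0F = mk⇔ (λ ()) (ℕ.<-irrefl refl)
        T-precedes 1F 1F = mk⇔ (λ ()) (ℕ.<-irrefl refl)
        T-precedes 2F 2F = mk⇔ (λ ()) (ℕ.<-irrefl refl)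
        T-precedes 3F 3F = mk⇔ (λ ()) (ℕ.<-irrefl refl)

        order-transitive : T (isTransitive order)
        order-transitive = isTransitive-complete order λ i j k i≺j j≺k →
          from (T-precedes i k) (ℕ.<-trans (to (T-precedes i j) i≺j) (to (T-precedes j k) j≺k))
          where open Equivalence

        T-between : ∀ i j k → T (between order i j k) ⇔ Btw (w i) (w j) (w k)
        T-between i j k =
          mk⇔ (Btwℕ⇒Btw (w∈C i) (w∈C j) (w∈C k)) (Btw⇒Btwℕ (w∈C i) (w∈C j) (w∈C k))
          ⇔-∘ ((((T-precedes i j ×-⇔ T-precedes j k) ⇔-∘ T-∧)
                ⊎-⇔ ((T-precedes k j ×-⇔ T-precedes j i) ⇔-∘ T-∧))
               ⇔-∘ T-∨)

        T-holds : ∀ l → T (holds order l) ⇔ Holds l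
        T-holds (btw i j k)  = T-between i j k
        T-holds (¬btw i j k) = mk⇔ (λ ¬b h → ¬b (from h)) (λ ¬h b → ¬h (to b)) ⇔-∘ T-not
          where open Equivalence (T-between i j k)

    -- The implicit proof of hs ⊢ l is found by evaluating the check.  If l failed, no ordering
    -- of the four points would be consistent with R there, contradicting R-4; as Holds l is
    -- decidable, refuting its negation suffices.
    rule-holds : ∀ hs l {valid : T (hs ⊢ l)} → All Holds hs → Holds l
    rule-holds hs l {valid} hs-hold = decidable-stable (Holds? l) λ ¬l →
      R-4 C ∣C∣≡4 λ (σ , σ-injective , σ-consistent) → let open Ordered σ σ-injective σ-consistent in
        ¬l (Equivalence.to (T-holds l)
             (⊢-sound hs l valid order order-transitive (All.map (Equivalence.from (T-holds _)) hs-hold)))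

  Btw-trans : ∀ {p x y z} → Btw p x y → Btw p y z → Btw p x z
  Btw-trans {x = x} {z = z} h₁ h₂ with x ≟ z
  ... | yes refl = ⊥-elim (Btw-unique₂₃ h₁ h₂)
  ... | no x≢z = rule-holds (Btw⇒≢₁₂ h₁) (Btw⇒≢₁₃ h₁) (Btw⇒≢₁₃ h₂) (Btw⇒≢₂₃ h₁) x≢z (Btw⇒≢₂₃ h₂)
    (btw 0F 1F 2F ∷ btw 0F 2F 3F ∷ []) (btw 0F 1F 3F) (h₁ ∷ h₂ ∷ [])

  Btw-same-side : ∀ {p a b c} → Btw a b c → p ≢ a → p ≢ b → p ≢ c →
                  ¬ Btw a p b → ¬ Btw b p c → ¬ Btw a p c →
                  (Btw p a b × Btw p b c) ⊎ (Btw p c b × Btw p b a)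
  Btw-same-side h p≢a p≢b p≢c ¬apb ¬bpc ¬apc with Btw-trichotomy p≢a (Btw⇒≢₁₂ h) p≢b
  ... | inj₁ pab        = inj₁ (pab , rule-holds p≢a p≢b p≢c (Btw⇒≢₁₂ h) (Btw⇒≢₁₃ h) (Btw⇒≢₂₃ h)
          (btw 1F 2F 3F ∷ ¬btw 1F 0F 2F ∷ ¬btw 2F 0F 3F ∷ ¬btw 1F 0F 3F ∷ btw 0F 1F 2F ∷ [])
          (btw 0F 2F 3F) (h ∷ ¬apb ∷ ¬bpc ∷ ¬apc ∷ pab ∷ []))
  ... | inj₂ (inj₁ apb) = ⊥-elim (¬apb apb)
  ... | inj₂ (inj₂ pba) = inj₂ (rule-holds p≢a p≢b p≢c (Btw⇒≢₁₂ h) (Btw⇒≢₁₃ h) (Btw⇒≢₂₃ h)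
          (btw 1F 2F 3F ∷ ¬btw 1F 0F 2F ∷ ¬btw 2F 0F 3F ∷ ¬btw 1F 0F 3F ∷ btw 0F 2F 1F ∷ [])
          (btw 0F 3F 2F) (h ∷ ¬apb ∷ ¬bpc ∷ ¬apc ∷ pba ∷ []) , pba)

  Btw-replace-end : ∀ {p a b c} → Btw a b c → Btw a p c → Btw b p c → ¬ Btw a p b → Btw a b p
  Btw-replace-end h apc bpc ¬apb =
    rule-holds (Btw⇒≢₁₂ apc ∘ sym) (Btw⇒≢₁₂ bpc ∘ sym) (Btw⇒≢₂₃ apc) (Btw⇒≢₁₂ h) (Btw⇒≢₁₃ h) (Btw⇒≢₂₃ h)
      (btw 1F 2F 3F ∷ btw 1F 0F 3F ∷ btw 2F 0F 3F ∷ ¬btw 1F 0F 2F ∷ []) (btw 1F 2F 0F)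
      (h ∷ apc ∷ bpc ∷ ¬apb ∷ [])

  Btw-separates-one-end : ∀ {p a b c} → Btw a b c → Btw a p b → ¬ Btw c p b
  Btw-separates-one-end h apb cpb =
    rule-holds (Btw⇒≢₁₂ apb ∘ sym) (Btw⇒≢₂₃ apb) (Btw⇒≢₁₂ cpb ∘ sym) (Btw⇒≢₁₂ h) (Btw⇒≢₁₃ h) (Btw⇒≢₂₃ h)
      (btw 1F 2F 3F ∷ btw 1F 0F 2F ∷ []) (¬btw 3F 0F 2F) (h ∷ apb ∷ []) cpb

  module OrderAround {p q : Fin n} (p≢q : p ≢ q) where

    left-left : ∀ {x y} → Btw x p q → Btw y p q → ¬ Btw x p y
    left-left {x} {y} xpq ypq with x ≟ y
    ... | yes refl = λ xpx → Btw⇒≢₁₃ xpx refl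
    ... | no x≢y   = rule-holds p≢q (Btw⇒≢₁₂ xpq ∘ sym) (Btw⇒≢₁₂ ypq ∘ sym)
                       (Btw⇒≢₁₃ xpq ∘ sym) (Btw⇒≢₁₃ ypq ∘ sym) x≢y
                       (btw 2F 0F 1F ∷ btw 3F 0F 1F ∷ []) (¬btw 2F 0F 3F) (xpq ∷ ypq ∷ [])

    right-right : ∀ {x y} → x ≢ p → y ≢ p → ¬ Btw x p q → ¬ Btw y p q → ¬ Btw x p y
    right-right {x} {y} x≢p y≢p ¬xpq ¬ypq with x ≟ y | x ≟ q | y ≟ q
    ... | yes refl | _        | _        = λ xpx → Btw⇒≢₁₃ xpx refl
    ... | no _     | yes refl | _        = ¬ypq ∘ Btw-sym
    ... | no _     | no _     | yes refl = ¬xpq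
    ... | no x≢y   | no x≢q   | no y≢q   =
      rule-holds p≢q (x≢p ∘ sym) (y≢p ∘ sym) (x≢q ∘ sym) (y≢q ∘ sym) x≢y
        (¬btw 2F 0F 1F ∷ ¬btw 3F 0F 1F ∷ []) (¬btw 2F 0F 3F) (¬xpq ∷ ¬ypq ∷ [])

    left-right : ∀ {x y} → Btw x p q → y ≢ p → ¬ Btw y p q → Btw x p y
    left-right {x} {y} xpq y≢p ¬ypq with y ≟ q
    ... | yes refl = xpq
    ... | no y≢q   = rule-holds p≢q (Btw⇒≢₁₂ xpq ∘ sym) (y≢p ∘ sym) (Btw⇒≢₁₃ xpq ∘ sym) (y≢q ∘ sym) x≢y
                       (btw 2F 0F 1F ∷ ¬btw 3F 0F 1F ∷ []) (btw 2F 0F 3F) (xpq ∷ ¬ypq ∷ [])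
      where
      x≢y : x ≢ y
      x≢y refl = ¬ypq xpq

    data Side (x : Fin n) : Set where
      left   : Btw x p q → Side x
      centre : x ≡ p → Side x
      right  : x ≢ p → ¬ Btw x p q → Side x

    side : ∀ x → Side x
    side x with x ≟ p | Btw? x p q
    ... | yes x≡p | _       = centre x≡p
    ... | no _    | yes xpq = left xpq
    ... | no x≢p  | no ¬xpq = right x≢p ¬xpq

    Precedes : ∀ {x y} → Side x → Side y → Set
    Precedes {x} {y} (left _)    (left _)    = Btw x y p
    Precedes         (left _)    _           = Unit.⊤
    Precedes         (centre _)  (right _ _) = Unit.⊤
    Precedes {x} {y} (right _ _) (right _ _) = Btw p x y
    Precedes         _           _           = ⊥

    Precedes-irrefl : ∀ {x} (s : Side x) → ¬ Precedes s s
    Precedes-irrefl (left _)    xxp = Btw⇒≢₁₂ xxp refl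
    Precedes-irrefl (centre _)  ()
    Precedes-irrefl (right _ _) pxx = Btw⇒≢₂₃ pxx refl

    Precedes-trans : ∀ {x y z} (sx : Side x) (sy : Side y) (sz : Side z) →
                     Precedes sx sy → Precedes sy sz → Precedes sx sz
    Precedes-trans (left _)    (left _)    (left _)    xyp yzp =
      Btw-sym (Btw-trans (Btw-sym yzp) (Btw-sym xyp))
    Precedes-trans (left _)    (centre _)  (left _)    _   ()
    Precedes-trans (left _)    (right _ _) (left _)    _   ()
    Precedes-trans (left _)    _           (centre _)  _   _   = tt
    Precedes-trans (left _)    _           (right _ _) _   _   = tt
    Precedes-trans (centre _)  (right _ _) (right _ _) _   _   = tt
    Precedes-trans (centre _)  (right _ _) (left _)    _   ()
    Precedes-trans (centre _)  (right _ _) (centre _)  _   ()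
    Precedes-trans (right _ _) (right _ _) (right _ _) pxy pyz = Btw-trans pxy pyz
    Precedes-trans (right _ _) (right _ _) (left _)    _   ()
    Precedes-trans (right _ _) (right _ _) (centre _)  _   ()

    Precedes-connex : ∀ {x y} → x ≢ y → (sx : Side x) (sy : Side y) → Precedes sx sy ⊎ Precedes sy sx
    Precedes-connex x≢y (left xpq) (left ypq) with Btw-trichotomy x≢y (Btw⇒≢₁₂ ypq) (Btw⇒≢₁₂ xpq)
    ... | inj₁ xyp        = inj₁ xyp
    ... | inj₂ (inj₁ yxp) = inj₂ yxp
    ... | inj₂ (inj₂ xpy) = ⊥-elim (left-left xpq ypq xpy)
    Precedes-connex x≢y (right x≢p ¬xpq) (right y≢p ¬ypq) with Btw-trichotomy (x≢p ∘ sym) x≢y (y≢p ∘ sym)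
    ... | inj₁ pxy        = inj₁ pxy
    ... | inj₂ (inj₁ xpy) = ⊥-elim (right-right x≢p y≢p ¬xpq ¬ypq xpy)
    ... | inj₂ (inj₂ pyx) = inj₂ pyx
    Precedes-connex x≢y (centre refl) (centre refl) = ⊥-elim (x≢y refl)
    Precedes-connex _   (left _)      (centre _)    = inj₁ tt
    Precedes-connex _   (left _)      (right _ _)   = inj₁ tt
    Precedes-connex _   (centre _)    (left _)      = inj₂ tt
    Precedes-connex _   (centre _)    (right _ _)   = inj₁ tt
    Precedes-connex _   (right _ _)   (left _)      = inj₂ tt
    Precedes-connex _   (right _ _)   (centre _)    = inj₂ tt

    Monotone : ∀ {x y z} → Side x → Side y → Side z → Set
    Monotone sx sy sz = (Precedes sx sy × Precedes sy sz) ⊎ (Precedes sz sy × Precedes sy sx)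

    Monotone-from-centre : ∀ {y z} → Btw p y z → (sy : Side y) (sz : Side z) → Monotone (centre refl) sy sz
    Monotone-from-centre pyz (centre y≡p)     _                 = ⊥-elim (Btw⇒≢₁₂ pyz (sym y≡p))
    Monotone-from-centre pyz _                (centre z≡p)      = ⊥-elim (Btw⇒≢₁₃ pyz (sym z≡p))
    Monotone-from-centre pyz (left _)         (left _)          = inj₂ (Btw-sym pyz , tt)
    Monotone-from-centre pyz (right _ _)      (right _ _)       = inj₁ (tt , pyz)
    Monotone-from-centre pyz (left ypq)       (right z≢p ¬zpq)  =
      ⊥-elim (Btw-unique₁₂ pyz (left-right ypq z≢p ¬zpq))
    Monotone-from-centre pyz (right y≢p ¬ypq) (left zpq)        =
      ⊥-elim (Btw-unique₁₂ pyz (Btw-sym (left-right zpq y≢p ¬ypq)))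

    Monotone-through-centre : ∀ {x z} → Btw x p z → (sx : Side x) (sz : Side z) → Monotone sx (centre refl) sz
    Monotone-through-centre xpz (centre x≡p)     _                = ⊥-elim (Btw⇒≢₁₂ xpz x≡p)
    Monotone-through-centre xpz _                (centre z≡p)     = ⊥-elim (Btw⇒≢₂₃ xpz (sym z≡p))
    Monotone-through-centre xpz (left _)         (right _ _)      = inj₁ (tt , tt)
    Monotone-through-centre xpz (right _ _)      (left _)         = inj₂ (tt , tt)
    Monotone-through-centre xpz (left xpq)       (left zpq)       = ⊥-elim (left-left xpq zpq xpz)
    Monotone-through-centre xpz (right x≢p ¬xpq) (right z≢p ¬zpq) = ⊥-elim (right-right x≢p z≢p ¬xpq ¬zpq xpz)

    Monotone-between : ∀ {x y z} → Btw x y z → (sx : Side x) (sy : Side y) (sz : Side z) → Monotone sx sy sz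
    Monotone-between xyz (centre refl) sy sz = Monotone-from-centre xyz sy sz
    Monotone-between xyz sx sy (centre refl) = swap (Monotone-from-centre (Btw-sym xyz) sy sx)
    Monotone-between xyz sx (centre refl) sz = Monotone-through-centre xyz sx sz
    Monotone-between xyz (left xpq) (left ypq) (left zpq)
      with Btw-same-side xyz (Btw⇒≢₁₂ xpq ∘ sym) (Btw⇒≢₁₂ ypq ∘ sym) (Btw⇒≢₁₂ zpq ∘ sym)
             (left-left xpq ypq) (left-left ypq zpq) (left-left xpq zpq)
    ... | inj₁ (pxy , pyz) = inj₂ (Btw-sym pyz , Btw-sym pxy)
    ... | inj₂ (pzy , pyx) = inj₁ (Btw-sym pyx , Btw-sym pzy)
    Monotone-between xyz (right x≢p ¬xpq) (right y≢p ¬ypq) (right z≢p ¬zpq) =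
      Btw-same-side xyz (x≢p ∘ sym) (y≢p ∘ sym) (z≢p ∘ sym)
        (right-right x≢p y≢p ¬xpq ¬ypq) (right-right y≢p z≢p ¬ypq ¬zpq) (right-right x≢p z≢p ¬xpq ¬zpq)
    Monotone-between xyz (left xpq) (left ypq) (right z≢p ¬zpq) =
      inj₁ (Btw-replace-end xyz (left-right xpq z≢p ¬zpq) (left-right ypq z≢p ¬zpq) (left-left xpq ypq) , tt)
    Monotone-between xyz (right x≢p ¬xpq) (right y≢p ¬ypq) (left zpq) =
      inj₂ (tt , Btw-sym (Btw-replace-end xyz (Btw-sym (left-right zpq x≢p ¬xpq))
                                              (Btw-sym (left-right zpq y≢p ¬ypq))
                                              (right-right x≢p y≢p ¬xpq ¬ypq)))
    Monotone-between xyz (left xpq) (right y≢p ¬ypq) (right z≢p ¬zpq) =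
      inj₁ (tt , Btw-sym (Btw-replace-end (Btw-sym xyz) (Btw-sym (left-right xpq z≢p ¬zpq))
                                                        (Btw-sym (left-right xpq y≢p ¬ypq))
                                                        (right-right z≢p y≢p ¬zpq ¬ypq)))
    Monotone-between xyz (right x≢p ¬xpq) (left ypq) (left zpq) =
      inj₂ (Btw-replace-end (Btw-sym xyz) (left-right zpq x≢p ¬xpq) (left-right ypq x≢p ¬xpq)
                                          (left-left zpq ypq) , tt)
    Monotone-between xyz (left xpq) (right y≢p ¬ypq) (left zpq) =
      ⊥-elim (Btw-separates-one-end xyz (left-right xpq y≢p ¬ypq) (left-right zpq y≢p ¬ypq))
    Monotone-between xyz (right x≢p ¬xpq) (left ypq) (right z≢p ¬zpq) =
      ⊥-elim (Btw-separates-one-end xyz (Btw-sym (left-right ypq x≢p ¬xpq))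
                                        (Btw-sym (left-right ypq z≢p ¬zpq)))

    _◁_ : Rel (Fin n) 0ℓ
    x ◁ y = Precedes (side x) (side y)

    ◁-isStrictTotalOrder : IsStrictTotalOrder _≡_ _◁_
    ◁-isStrictTotalOrder = record
      { isStrictPartialOrder = record
        { isEquivalence = isEquivalence
        ; irrefl        = λ { {x} refl → Precedes-irrefl (side x) }
        ; trans         = λ {x} {y} {z} → Precedes-trans (side x) (side y) (side z)
        ; <-resp-≈      = resp₂ _◁_
        }
      ; compare = compare
      }
      where
      ◁-asym : ∀ {x y} → x ◁ y → ¬ y ◁ x
      ◁-asym {x} {y} x◁y y◁x = Precedes-irrefl (side x) (Precedes-trans (side x) (side y) (side x) x◁y y◁x)

      compare : ∀ x y → Tri (x ◁ y) (x ≡ y) (y ◁ x)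
      compare x y with x ≟ y
      ... | yes refl = tri≈ (Precedes-irrefl (side x)) refl (Precedes-irrefl (side x))
      ... | no x≢y with Precedes-connex x≢y (side x) (side y)
      ... | inj₁ x◁y = tri< x◁y x≢y (◁-asym x◁y)
      ... | inj₂ y◁x = tri> (◁-asym y◁x) x≢y y◁x

    consistent : Consistent ⊤ R
    consistent = rank ◁-isStrictTotalOrder , (λ _ _ _ _ → rank-injective ◁-isStrictTotalOrder) , λ t r →
      ⊎.map (×.map mono mono) (×.map mono mono)
        (Monotone-between (via t r refl refl refl) (side (a t)) (side (b t)) (side (c t)))
      where
      mono : ∀ {x y} → x ◁ y → rank ◁-isStrictTotalOrder x < rank ◁-isStrictTotalOrder y
      mono = rank-monotone ◁-isStrictTotalOrder

Consistent-mono : ∀ {n} {S C : Subset n} {T T′ : TripletPred n} →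
                  C ⊆ S → (∀ t → T′ t → T t) → Consistent S T → Consistent C T′
Consistent-mono C⊆S T′⊆T (σ , σ-injective , σ-consistent) =
  σ , (λ x y x∈C y∈C → σ-injective x y (C⊆S x∈C) (C⊆S y∈C)) , λ t → σ-consistent t ∘ T′⊆T t

consistent-from-four-points : ∀ n (R : TripletPred n) → RespectsSame R → Dense R → FourPointConsistent R →
                              Consistent ⊤ R
consistent-from-four-points 0 R _ _ _ =
  toℕ , (λ _ _ _ _ → toℕ-injective) , λ { (triplet () _ _ _ _ _) _ }
consistent-from-four-points 1 R _ _ _ =
  toℕ , (λ _ _ _ _ → toℕ-injective) , λ { (triplet 0F 0F _ a≢b _ _) _ → ⊥-elim (a≢b refl) }
consistent-from-four-points (suc (suc _)) R R-resp R-dense R-4 =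
  FromFourPoints.OrderAround.consistent R R-resp R-dense R-4 {0F} {1F} (λ ())

lemma9 : (n : ℕ) (R : TripletPred n) → RespectsSame R → Dense R →
    Consistent ⊤ R ⇔ (¬ Σ (Subset n) (λ C → ∣ C ∣ ≡ 4 × ¬ Consistent C (Restrict R C)))
lemma9 n R R-resp R-dense = mk⇔
  (λ R-consistent (C , _ , ¬C-consistent) → ¬C-consistent (Consistent-mono ⊆⊤ (λ _ → proj₁) R-consistent))
  (λ no-bad-quadruple → consistent-from-four-points n R R-resp R-dense
    λ C ∣C∣≡4 ¬C-consistent → no-bad-quadruple (C , ∣C∣≡4 , ¬C-consistent))
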